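{- Let $L$ be the set of pairs $(u,x)$ of words of the same length $m\ge 0$, where $u=u_0u_1\cdots u_{m-1}$ is a word over $\{0,1\}$ and $x=x_0x_1\cdots x_{m-1}$ is a word over $\{0,1,2\}$, such that $u$ is a Zeckendorf word, $x$ is a Chung-Graham word, and $\mathrm{val}(u)=\mathrm{val}(x)$. Then $L$, viewed as a language over the alphabet $\{0,1\}\times\{0,1,2\}$ (the pair being read in parallel, least significant digit first), is accepted by a finite automaton.
   Context: Fibonacci numbers: $F_0=0$, $F_1=1$, $F_{n+1}=F_n+F_{n-1}$ for $n\ge1$. For a word $a=a_0a_1\cdots a_{m-1}$ over $\{0,1,2\}$ (written least significant digit first), its value is $\mathrm{val}(a)=\sum_{i=0}^{m-1} a_iF_{i+2}$; trailing zeros (at the most significant end) do not change the value. A Zeckendorf word is a word over $\{0,1\}$ with $a_ia_{i+1}=0$ for all $i$ (no two consecutive 1's). A Chung-Graham word is a word over $\{0,1,2\}$ such that $a_i=0$ whenever $i$ is odd, and whenever $i<j$ are even indices with $a_i=a_j=2$ there is an even $k$ with $i<k<j$ and $a_k=0$. (Every nonnegative integer has a unique Zeckendorf representation and a unique Chung-Graham representation, up to trailing zeros.) -}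

module Defs where

open import Data.Nat using (ℕ; zero; suc; _+_; _*_; _<_)
open import Data.Nat.Divisibility using (_∣_)
open import Data.Fin using (Fin; toℕ)
open import Data.List using (List; []; _∷_; map; foldl)
open import Data.Bool using (Bool; true)
open import Data.Product using (_×_; ∃-syntax; proj₁; proj₂)
open import Relation.Nullary using (¬_)
open import Relation.Binary.PropositionalEquality using (_≡_)

fib : ℕ → ℕ
fib 0 = 0
fib 1 = 1
fib (suc (suc n)) = fib (suc n) + fib n

-- Words are lists of digits, least significant digit first (index 0 = head).
-- val starting at position k : Σ_i a_i F_{k+i+2}
valFrom : ℕ → List ℕ → ℕ
valFrom k [] = 0
valFrom k (a ∷ as) = a * fib (k + 2) + valFrom (suc k) as

val : List ℕ → ℕ
val = valFrom 0

-- digit at index i (0 beyond the end of the word, i.e. implicit trailing zeros)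
at : List ℕ → ℕ → ℕ
at [] i = 0
at (a ∷ as) zero = a
at (a ∷ as) (suc i) = at as i

Even : ℕ → Set
Even i = 2 ∣ i

IsZeckendorf : List ℕ → Set
IsZeckendorf a = ∀ i → at a i * at a (suc i) ≡ 0

IsChungGraham : List ℕ → Set
IsChungGraham a =
  (∀ i → ¬ Even i → at a i ≡ 0) ×
  (∀ i j → Even i → Even j → i < j → at a i ≡ 2 → at a j ≡ 2 →
     ∃[ k ] (Even k × i < k × k < j × at a k ≡ 0))

record DFA (A : Set) : Set where
  field
    nStates : ℕ
    start   : Fin nStates
    δ       : Fin nStates → A → Fin nStates
    final   : Fin nStates → Bool

Accepts : {A : Set} → DFA A → List A → Set
Accepts D w = DFA.final D (foldl (DFA.δ D) (DFA.start D) w) ≡ true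

Σ₂₃ : Set
Σ₂₃ = Fin 2 × Fin 3

upper : List Σ₂₃ → List ℕ
upper w = map (λ p → toℕ (proj₁ p)) w

lower : List Σ₂₃ → List ℕ
lower w = map (λ p → toℕ (proj₂ p)) w

InL : List Σ₂₃ → Set
InL w = IsZeckendorf (upper w) × IsChungGraham (lower w) × val (upper w) ≡ val (lower w)

-- Read u and x in parallel, least significant digit first, and let Pu and Px be the values of
-- the prefixes of length k.  Whether such a pair of prefixes extends to a word of L depends only on
-- the last digit of u, on the Chung–Graham state (parity of the position, and whether a 2 still
-- awaits a separating 0) and on D = Pu − Px.  Write D = a F(k+2) + b F(k+1) and call (a , b) the
-- carry: a letter with digit difference d turns D into D + d F(k+2), and the new carry (a′ , b′) is
-- the one with back (a′ , b′) d = (a , b).  The digit systems confine Pu and Px to Fibonacci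
-- intervals (a Zeckendorf prefix ending in 0 is below F(k+1), and so on), and a backward induction
-- from the end of the word shows that the carry of every completable prefix lies in a fixed finite
-- table, inside which it is determined by D once k ≥ 1.  Hence finitely many states suffice.  The
-- finite facts are checked by computation, comparing forms through the criterion
-- a + b ≥ 0 and 2a + b ≥ 0  ⇒  a F(k+2) + b F(k+1) ≥ 0 for every k.

module Submission where

open import Defs
open import Data.Bool using (Bool; true; false; not; if_then_else_)
open import Data.Empty using (⊥-elim)
open import Data.Fin using (toℕ)
open import Data.Integer as ℤ using (ℤ; +_; _+_; _*_; _-_; 0ℤ; 1ℤ; -1ℤ; _≤_; _<_; +≤+; +<+)
import Data.Integer.Properties as ℤ
open import Data.Integer.Tactic.RingSolver using (solve-∀)
open import Data.List using (List; []; _∷_; map; foldl; concatMap; length; lookup; cartesianProduct; allFin)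
open import Data.List.Membership.Propositional using (_∈_; find; lose)
open import Data.List.Membership.Propositional.Properties
  using (∈-cartesianProduct⁺; ∈-map⁺; ∈-allFin; ∈-concatMap⁺; ∈-lookup)
import Data.List.Relation.Unary.All as All
open All using (All)
import Data.List.Relation.Unary.Any as Any
open Any using (here; there)
open import Data.List.Relation.Unary.Any.Properties using (lookup-index)
import Data.Maybe as Maybe
open Maybe using (Maybe; just; nothing)
open import Data.Maybe.Properties using (just-injective)
import Data.Maybe.Relation.Unary.All as MaybeAll
open MaybeAll using () renaming (All to MaybeAll)
open import Data.Nat as ℕ using (ℕ; zero; suc; s≤s; z≤n)
open import Data.Nat.Divisibility using (divides; ∣-refl; ∣1⇒≡1; ∣m+n∣m⇒∣n; ∣m∣n⇒∣m+n)
import Data.Nat.Properties as ℕ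
open import Data.Product using (_×_; _,_; proj₁; proj₂; ∃-syntax)
open import Data.Product.Function.NonDependent.Propositional using (_×-⇔_)
open import Data.Product.Properties using (≡-dec)
open import Data.Sum using (_⊎_; inj₁; inj₂)
open import Function.Bundles using (_⇔_; mk⇔; Equivalence)
import Function.Properties.Equivalence as ⇔
open import Relation.Binary.Definitions using (DecidableEquality)
open import Relation.Binary.PropositionalEquality
open import Relation.Nullary using (Dec; yes; no; does; ¬_)
open import Relation.Nullary.Decidable as Dec using (_×-dec_; _⊎-dec_; from-yes; dec-true)
import Relation.Unary as U

-- Partial automata

data Runs {S A : Set} (step : S → A → Maybe S) : S → List A → Set where
  []  : ∀ {s} → Runs step s []
  _∷_ : ∀ {s a s′ as} → step s a ≡ just s′ → Runs step s′ as → Runs step s (a ∷ as)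

module _ {S A : Set} {step : S → A → Maybe S} where

  runs-∷ : ∀ {s s′ a as} → step s a ≡ just s′ → Runs step s (a ∷ as) ⇔ Runs step s′ as
  runs-∷ {as = as} eq = mk⇔
    (λ { (eq′ ∷ r) → subst (λ t → Runs step t as) (just-injective (trans (sym eq′) eq)) r })
    (eq ∷_)

  runs-stuck : ∀ {s a as} → step s a ≡ nothing → ¬ Runs step s (a ∷ as)
  runs-stuck eq (eq′ ∷ _) with () ← trans (sym eq) eq′

  runs⇔sem : (Sem : S → List A → Set) →
             (∀ s → Sem s []) →
             (∀ {s a s′ as} → step s a ≡ just s′ → Sem s (a ∷ as) ⇔ Sem s′ as) →
             (∀ {s a as} → step s a ≡ nothing → ¬ Sem s (a ∷ as)) →
             ∀ s w → Runs step s w ⇔ Sem s w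
  runs⇔sem Sem nil _    _     s []       = mk⇔ (λ _ → nil s) (λ _ → [])
  runs⇔sem Sem nil cons stuck s (a ∷ as) = by-step (step s a) refl
    where
    by-step : ∀ m → step s a ≡ m → Runs step s (a ∷ as) ⇔ Sem s (a ∷ as)
    by-step (just s′) eq = ⇔.trans (runs-∷ eq) (⇔.trans (runs⇔sem Sem nil cons stuck s′ as) (⇔.sym (cons eq)))
    by-step nothing   eq = mk⇔ (λ r → ⊥-elim (runs-stuck eq r)) (λ sem → ⊥-elim (stuck eq sem))

module _ {S T A B C : Set} (f : S → A → Maybe S) (g : T → B → Maybe T) (p : C → A) (q : C → B) where

  zipStep : S × T → C → Maybe (S × T)
  zipStep (s , t) c = Maybe.zip (f s (p c)) (g t (q c))

  runs-zipStep : ∀ s t w → Runs zipStep (s , t) w ⇔ (Runs f s (map p w) × Runs g t (map q w))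
  runs-zipStep _ _ []      = mk⇔ (λ _ → [] , []) (λ _ → [])
  runs-zipStep s t (c ∷ w) = by-step (f s (p c)) (g t (q c)) refl refl
    where
    by-step : ∀ m n → f s (p c) ≡ m → g t (q c) ≡ n →
              Runs zipStep (s , t) (c ∷ w) ⇔ (Runs f s (map p (c ∷ w)) × Runs g t (map q (c ∷ w)))
    by-step (just s′) (just t′) eq₁ eq₂ =
      ⇔.trans (runs-∷ (cong₂ Maybe.zip eq₁ eq₂))
              (⇔.trans (runs-zipStep s′ t′ w) (⇔.sym (runs-∷ eq₁ ×-⇔ runs-∷ eq₂)))
    by-step nothing   _         eq₁ _   = mk⇔
      (λ r → ⊥-elim (runs-stuck (cong (λ m → Maybe.zip m (g t (q c))) eq₁) r))
      (λ (r , _) → ⊥-elim (runs-stuck eq₁ r))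
    by-step (just _)  nothing   eq₁ eq₂ = mk⇔
      (λ r → ⊥-elim (runs-stuck (cong₂ Maybe.zip eq₁ eq₂) r))
      (λ (_ , r) → ⊥-elim (runs-stuck eq₂ r))

∀? : ∀ {A : Set} {P : A → Set} {xs : List A} → (∀ x → x ∈ xs) → U.Decidable P → Dec (∀ x → P x)
∀? complete P? =
  Dec.map′ (λ all x → All.lookup all (complete x)) (λ f → All.tabulate (λ {x} _ → f x)) (All.all? P? _)

finite-reachable⇒DFA : ∀ {Q A : Set} (step : Q → A → Q) (q₀ : Q) (accepting : Q → Bool) (qs : List Q) →
                       q₀ ∈ qs → (∀ {q} a → q ∈ qs → step q a ∈ qs) →
                       ∃[ D ] ∀ w → Accepts {A} D w ⇔ (accepting (foldl step q₀ w) ≡ true)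
finite-reachable⇒DFA {A = A} step q₀ accepting qs q₀∈ closed =
  D , λ w → mk⇔ (trans (sym (same-verdict w))) (trans (same-verdict w))
  where
  D : DFA A
  D = record
    { nStates = length qs
    ; start   = Any.index q₀∈
    ; δ       = λ i a → Any.index (closed a (∈-lookup i))
    ; final   = λ i → accepting (lookup qs i)
    }
  simulates : ∀ w i → lookup qs (foldl (DFA.δ D) i w) ≡ foldl step (lookup qs i) w
  simulates []      i = refl
  simulates (a ∷ w) i =
    trans (simulates w _) (cong (λ q → foldl step q w) (sym (lookup-index (closed a (∈-lookup i)))))
  same-verdict : ∀ w → DFA.final D (foldl (DFA.δ D) (DFA.start D) w) ≡ accepting (foldl step q₀ w)
  same-verdict w =
    cong accepting (trans (simulates w (Any.index q₀∈)) (cong (λ q → foldl step q w) (sym (lookup-index q₀∈))))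

-- Zeckendorf and Chung–Graham words

zStep : Bool → ℕ → Maybe Bool
zStep _     zero    = just false
zStep false (suc _) = just true
zStep true  (suc _) = nothing

ZeckendorfAfter : Bool → List ℕ → Set
ZeckendorfAfter nonzero w = (nonzero ≡ true → at w 0 ≡ 0) × IsZeckendorf w

isZeckendorf-∷ : ∀ {a as} → IsZeckendorf (a ∷ as) ⇔ (a ℕ.* at as 0 ≡ 0 × IsZeckendorf as)
isZeckendorf-∷ = mk⇔ (λ z → z 0 , λ i → z (suc i)) λ where
  (h , z) zero    → h
  (h , z) (suc i) → z i

zeckendorf⇔runs : ∀ w → IsZeckendorf w ⇔ Runs zStep false w
zeckendorf⇔runs w =
  ⇔.sym (⇔.trans (runs⇔sem ZeckendorfAfter (λ _ → (λ _ → refl) , (λ _ → refl)) cons stuck false w)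
                 (mk⇔ proj₂ ((λ ()) ,_)))
  where
  open Equivalence
  cons : ∀ {b a b′ as} → zStep b a ≡ just b′ → ZeckendorfAfter b (a ∷ as) ⇔ ZeckendorfAfter b′ as
  cons {a = zero} refl = mk⇔ (λ (_ , z) → (λ ()) , proj₂ (to isZeckendorf-∷ z))
                             (λ (_ , z) → (λ _ → refl) , from isZeckendorf-∷ (refl , z))
  cons {false} {suc n} refl = mk⇔
    (λ (_ , z) → let h , z′ = to isZeckendorf-∷ z in next-zero h , z′)
    (λ (h , z) → (λ ()) , from isZeckendorf-∷ (trans (cong (suc n ℕ.*_) (h refl)) (ℕ.*-zeroʳ (suc n)) , z))
    where
    next-zero : ∀ {m} → suc n ℕ.* m ≡ 0 → true ≡ true → m ≡ 0
    next-zero h _ with ℕ.m*n≡0⇒m≡0∨n≡0 (suc n) h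
    ... | inj₂ m≡0 = m≡0
  stuck : ∀ {b a as} → zStep b a ≡ nothing → ¬ ZeckendorfAfter b (a ∷ as)
  stuck {true} {suc _} refl (h , _) with () ← h refl

-- pending: an even-position 2 has been read and no even-position 0 since.
record CGState : Set where
  constructor cg
  field
    atEven  : Bool
    pending : Bool

cgStep : CGState → ℕ → Maybe CGState
cgStep (cg false p) zero    = just (cg true p)
cgStep (cg false p) (suc _) = nothing
cgStep (cg true  _) zero    = just (cg false false)
cgStep (cg true  p) 2       = if p then nothing else just (cg false true)
cgStep (cg true  p) _       = just (cg false p)

-- Whether position i of a suffix is even in the whole word, e telling whether the suffix starts at
-- an even position.
EvenAt : Bool → ℕ → Set
EvenAt e zero    = e ≡ true
EvenAt e (suc i) = EvenAt (not e) i

OddZero : Bool → List ℕ → Set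
OddZero e w = ∀ i → EvenAt (not e) i → at w i ≡ 0

ZeroBetweenTwos : Bool → List ℕ → Set
ZeroBetweenTwos e w = ∀ i j → EvenAt e i → EvenAt e j → i ℕ.< j → at w i ≡ 2 → at w j ≡ 2 →
                      ∃[ k ] (EvenAt e k × i ℕ.< k × k ℕ.< j × at w k ≡ 0)

ZeroBeforeTwos : Bool → List ℕ → Set
ZeroBeforeTwos e w = ∀ j → EvenAt e j → at w j ≡ 2 → ∃[ k ] (EvenAt e k × k ℕ.< j × at w k ≡ 0)

ChungGrahamAfter : CGState → List ℕ → Set
ChungGrahamAfter (cg e p) w = OddZero e w × ZeroBetweenTwos e w × (p ≡ true → ZeroBeforeTwos e w)

oddZero-∷ : ∀ e {a as} → OddZero e (a ∷ as) ⇔ ((not e ≡ true → a ≡ 0) × OddZero (not e) as)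
oddZero-∷ _ = mk⇔ (λ z → z 0 , λ i → z (suc i)) λ where
  (h , z) zero    → h
  (h , z) (suc i) → z i

zeroBetweenTwos-∷ : ∀ e {a as} →
  ZeroBetweenTwos e (a ∷ as) ⇔ (ZeroBetweenTwos (not e) as × (e ≡ true → a ≡ 2 → ZeroBeforeTwos (not e) as))
zeroBetweenTwos-∷ e {a} {as} = mk⇔ (λ z → later z , first z) earlier
  where
  later : ZeroBetweenTwos e (a ∷ as) → ZeroBetweenTwos (not e) as
  later z i j ei ej i<j ai aj with z (suc i) (suc j) ei ej (s≤s i<j) ai aj
  ... | suc k , ek , s≤s i<k , s≤s k<j , ak = k , ek , i<k , k<j , ak
  first : ZeroBetweenTwos e (a ∷ as) → e ≡ true → a ≡ 2 → ZeroBeforeTwos (not e) as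
  first z e0 a≡2 j ej aj with z 0 (suc j) e0 ej (s≤s z≤n) a≡2 aj
  ... | suc k , ek , _ , s≤s k<j , ak = k , ek , k<j , ak
  earlier : ZeroBetweenTwos (not e) as × (e ≡ true → a ≡ 2 → ZeroBeforeTwos (not e) as) →
            ZeroBetweenTwos e (a ∷ as)
  earlier (z , _) (suc i) (suc j) ei ej (s≤s i<j) ai aj with z i j ei ej i<j ai aj
  ... | k , ek , i<k , k<j , ak = suc k , ek , s≤s i<k , s≤s k<j , ak
  earlier (_ , f) zero (suc j) e0 ej _ a≡2 aj with f e0 a≡2 j ej aj
  ... | k , ek , k<j , ak = suc k , ek , s≤s z≤n , s≤s k<j , ak

zeroBeforeTwos-skip : ∀ e {a as} → (e ≡ true → a ≢ 0 × a ≢ 2) →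
                      ZeroBeforeTwos e (a ∷ as) ⇔ ZeroBeforeTwos (not e) as
zeroBeforeTwos-skip e {a} {as} plain = mk⇔ later earlier
  where
  later : ZeroBeforeTwos e (a ∷ as) → ZeroBeforeTwos (not e) as
  later z j ej aj with z (suc j) ej aj
  ... | zero  , e0 , _ , a≡0       = ⊥-elim (proj₁ (plain e0) a≡0)
  ... | suc k , ek , s≤s k<j , ak = k , ek , k<j , ak
  earlier : ZeroBeforeTwos (not e) as → ZeroBeforeTwos e (a ∷ as)
  earlier z zero    e0 a≡2 = ⊥-elim (proj₂ (plain e0) a≡2)
  earlier z (suc j) ej aj with z j ej aj
  ... | k , ek , k<j , ak = suc k , ek , s≤s k<j , ak

zeroBeforeTwos-after-zero : ∀ {as} → ZeroBeforeTwos true (0 ∷ as)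
zeroBeforeTwos-after-zero (suc j) _ _ = 0 , refl , s≤s z≤n , refl

zeroBeforeTwos-two : ∀ {as} → ¬ ZeroBeforeTwos true (2 ∷ as)
zeroBeforeTwos-two z with z 0 refl refl
... | _ , _ , () , _

drop-fst-⇔ : ∀ {A B : Set} → A → (A × B) ⇔ B
drop-fst-⇔ a = mk⇔ proj₂ (a ,_)

drop-snd-⇔ : ∀ {A B : Set} → B → (A × B) ⇔ A
drop-snd-⇔ b = mk⇔ proj₁ (_, b)

→-⇔ : ∀ {A B C : Set} → B ⇔ C → (A → B) ⇔ (A → C)
→-⇔ B⇔C = mk⇔ (λ f a → Equivalence.to B⇔C (f a)) (λ g a → Equivalence.from B⇔C (g a))

chungGrahamAfter⇔runs : ∀ c w → Runs cgStep c w ⇔ ChungGrahamAfter c w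
chungGrahamAfter⇔runs = runs⇔sem ChungGrahamAfter nil cons stuck
  where
  nil : ∀ c → ChungGrahamAfter c []
  nil (cg _ _) = (λ _ _ → refl) , (λ _ _ _ _ _ ()) , (λ _ _ _ ())
  plain : ∀ {p a as} → a ≢ 0 → a ≢ 2 →
          ChungGrahamAfter (cg true p) (a ∷ as) ⇔ ChungGrahamAfter (cg false p) as
  plain a≢0 a≢2 = ⇔.trans (oddZero-∷ true) (drop-fst-⇔ (λ ()))
              ×-⇔ ⇔.trans (zeroBetweenTwos-∷ true) (drop-snd-⇔ (λ _ a≡2 → ⊥-elim (a≢2 a≡2)))
              ×-⇔ →-⇔ (zeroBeforeTwos-skip true (λ _ → a≢0 , a≢2))
  cons : ∀ {c a c′ as} → cgStep c a ≡ just c′ → ChungGrahamAfter c (a ∷ as) ⇔ ChungGrahamAfter c′ as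
  cons {cg false _} {zero} refl = ⇔.trans (oddZero-∷ false) (drop-fst-⇔ (λ _ → refl))
                              ×-⇔ ⇔.trans (zeroBetweenTwos-∷ false) (drop-snd-⇔ (λ ()))
                              ×-⇔ →-⇔ (zeroBeforeTwos-skip false (λ ()))
  cons {cg true _} {zero} refl = ⇔.trans (oddZero-∷ true) (drop-fst-⇔ (λ ()))
                             ×-⇔ ⇔.trans (zeroBetweenTwos-∷ true) (drop-snd-⇔ (λ _ ()))
                             ×-⇔ mk⇔ (λ _ ()) (λ _ _ → zeroBeforeTwos-after-zero)
  cons {cg true false} {2} refl = ⇔.trans (oddZero-∷ true) (drop-fst-⇔ (λ ()))
                              ×-⇔ mk⇔ (λ (z , _) → let z′ , f = Equivalence.to (zeroBetweenTwos-∷ true) z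
                                                   in z′ , λ _ → f refl refl)
                                      (λ (z′ , f) → Equivalence.from (zeroBetweenTwos-∷ true)
                                                                     (z′ , λ _ _ → f refl) , λ ())
  cons {cg true _} {1} refl = plain (λ ()) (λ ())
  cons {cg true _} {suc (suc (suc _))} refl = plain (λ ()) (λ ())
  stuck : ∀ {c a as} → cgStep c a ≡ nothing → ¬ ChungGrahamAfter c (a ∷ as)
  stuck {cg false _} {suc _} refl (oz , _) with () ← oz 0 refl
  stuck {cg true true} {2} refl (_ , _ , zb) = zeroBeforeTwos-two (zb refl)

evenAt-dichotomy : ∀ e i → EvenAt e i ⊎ EvenAt (not e) i
evenAt-dichotomy true  zero    = inj₁ refl
evenAt-dichotomy false zero    = inj₂ refl
evenAt-dichotomy e     (suc i) = evenAt-dichotomy (not e) i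

evenAt-exclusive : ∀ e i → EvenAt e i → ¬ EvenAt (not e) i
evenAt-exclusive true  zero    _ ()
evenAt-exclusive false zero    ()
evenAt-exclusive e     (suc i) = evenAt-exclusive (not e) i

even⇔evenAt : ∀ i → Even i ⇔ EvenAt true i
even⇔evenAt i = mk⇔ (to i) (from i)
  where
  to : ∀ i → Even i → EvenAt true i
  to zero          _ = refl
  to (suc zero)    2∣1 with () ← ∣1⇒≡1 2∣1
  to (suc (suc i)) 2∣i+2 = to i (∣m+n∣m⇒∣n 2∣i+2 ∣-refl)
  from : ∀ i → EvenAt true i → Even i
  from zero          _ = divides 0 refl
  from (suc (suc i)) e = ∣m∣n⇒∣m+n ∣-refl (from i e)

odd⇔evenAt : ∀ i → (¬ Even i) ⇔ EvenAt false i
odd⇔evenAt i = mk⇔ odd (λ e-odd e → evenAt-exclusive true i (Equivalence.to (even⇔evenAt i) e) e-odd)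
  where
  odd : ¬ Even i → EvenAt false i
  odd ¬even with evenAt-dichotomy true i
  ... | inj₁ e-even = ⊥-elim (¬even (Equivalence.from (even⇔evenAt i) e-even))
  ... | inj₂ e-odd  = e-odd

chungGraham⇔runs : ∀ w → IsChungGraham w ⇔ Runs cgStep (cg true false) w
chungGraham⇔runs w = ⇔.sym (⇔.trans (chungGrahamAfter⇔runs (cg true false) w) (mk⇔ forget recall))
  where
  even⇒ : ∀ {i} → Even i → EvenAt true i
  even⇒ = Equivalence.to (even⇔evenAt _)
  ⇒even : ∀ {i} → EvenAt true i → Even i
  ⇒even = Equivalence.from (even⇔evenAt _)
  forget : ChungGrahamAfter (cg true false) w → IsChungGraham w
  forget (odd , between , _) = (λ i ¬even → odd i (Equivalence.to (odd⇔evenAt i) ¬even)) , separated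
    where
    separated : ∀ i j → Even i → Even j → i ℕ.< j → at w i ≡ 2 → at w j ≡ 2 →
                ∃[ k ] (Even k × i ℕ.< k × k ℕ.< j × at w k ≡ 0)
    separated i j ei ej i<j ai aj with between i j (even⇒ ei) (even⇒ ej) i<j ai aj
    ... | k , ek , i<k , k<j , ak = k , ⇒even ek , i<k , k<j , ak
  recall : IsChungGraham w → ChungGrahamAfter (cg true false) w
  recall (odd , separated) = (λ i e-odd → odd i (Equivalence.from (odd⇔evenAt i) e-odd)) , between , λ ()
    where
    between : ZeroBetweenTwos true w
    between i j ei ej i<j ai aj with separated i j (⇒even ei) (⇒even ej) i<j ai aj
    ... | k , ek , i<k , k<j , ak = k , even⇒ ek , i<k , k<j , ak

-- Fibonacci linear forms

F : ℕ → ℤ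
F n = + fib n

Form : Set
Form = ℤ × ℤ

⟦_⟧ : Form → ℕ → ℤ
⟦ a , b ⟧ k = a * F (suc (suc k)) + b * F (suc k)

infixl 6 _⊕_ _⊖_

_⊕_ : Form → Form → Form
(a , b) ⊕ (c , d) = a + c , b + d

_⊖_ : Form → Form → Form
(a , b) ⊖ (c , d) = a - c , b - d

shift : Form → Form
shift (a , b) = a + b , a

top : ℤ → Form
top d = d , 0ℤ

back : Form → ℤ → Form
back σ d = shift σ ⊖ top d

_≟F_ : DecidableEquality Form
_≟F_ = ≡-dec ℤ._≟_ ℤ._≟_

open import Data.List.Membership.DecPropositional _≟F_ using (_∈?_)

F-suc-suc : ∀ n → F (suc (suc n)) ≡ F (suc n) + F n
F-suc-suc n = ℤ.pos-+ (fib (suc n)) (fib n)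

⟦⟧-⊕ : ∀ v w k → ⟦ v ⊕ w ⟧ k ≡ ⟦ v ⟧ k + ⟦ w ⟧ k
⟦⟧-⊕ (a , b) (c , d) k = linear a b c d (F (suc (suc k))) (F (suc k))
  where
  linear : ∀ a b c d f g → (a + c) * f + (b + d) * g ≡ (a * f + b * g) + (c * f + d * g)
  linear = solve-∀

⟦⟧-⊖ : ∀ v w k → ⟦ v ⊖ w ⟧ k ≡ ⟦ v ⟧ k - ⟦ w ⟧ k
⟦⟧-⊖ (a , b) (c , d) k = linear a b c d (F (suc (suc k))) (F (suc k))
  where
  linear : ∀ a b c d f g → (a - c) * f + (b - d) * g ≡ (a * f + b * g) - (c * f + d * g)
  linear = solve-∀

⟦⟧-shift : ∀ v k → ⟦ shift v ⟧ k ≡ ⟦ v ⟧ (suc k)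
⟦⟧-shift (a , b) k = begin
  (a + b) * F (2 ℕ.+ k) + a * F (1 ℕ.+ k)       ≡⟨ regroup a b (F (2 ℕ.+ k)) (F (1 ℕ.+ k)) ⟩
  a * (F (2 ℕ.+ k) + F (1 ℕ.+ k)) + b * F (2 ℕ.+ k)
    ≡⟨ cong (λ f → a * f + b * F (2 ℕ.+ k)) (F-suc-suc (suc k)) ⟨
  a * F (3 ℕ.+ k) + b * F (2 ℕ.+ k)             ∎
  where
  open ≡-Reasoning
  regroup : ∀ a b f g → (a + b) * f + a * g ≡ a * (f + g) + b * f
  regroup = solve-∀

⟦⟧-zero : ∀ a b → ⟦ a , b ⟧ 0 ≡ a + b
⟦⟧-zero a b = cong₂ _+_ (ℤ.*-identityʳ a) (ℤ.*-identityʳ b)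

⟦⟧-suc : ∀ a b j → ⟦ a , b ⟧ (suc j) ≡ F j * (a + b) + F (suc j) * (a + (a + b))
⟦⟧-suc a b j = begin
  a * F (3 ℕ.+ j) + b * F (2 ℕ.+ j)
    ≡⟨ cong₂ (λ f g → a * f + b * g) (trans (F-suc-suc (suc j)) (cong (_+ F (suc j)) (F-suc-suc j)))
                                      (F-suc-suc j) ⟩
  a * ((F (suc j) + F j) + F (suc j)) + b * (F (suc j) + F j)
    ≡⟨ regroup a b (F j) (F (suc j)) ⟩
  F j * (a + b) + F (suc j) * (a + (a + b))
    ∎
  where
  open ≡-Reasoning
  regroup : ∀ a b f g → a * ((g + f) + g) + b * (g + f) ≡ f * (a + b) + g * (a + (a + b))
  regroup = solve-∀

⟦top⟧ : ∀ d k → ⟦ top d ⟧ k ≡ d * F (suc (suc k))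
⟦top⟧ d k = ℤ.+-identityʳ (d * F (suc (suc k)))

⟦back⟧ : ∀ σ d k → ⟦ back σ d ⟧ k ≡ ⟦ σ ⟧ (suc k) - ⟦ top d ⟧ k
⟦back⟧ σ d k = trans (⟦⟧-⊖ (shift σ) (top d) k) (cong (_- ⟦ top d ⟧ k) (⟦⟧-shift σ k))

back-represents : ∀ σ d k D → ⟦ back σ d ⟧ k ≡ D ⇔ ⟦ σ ⟧ (suc k) ≡ D + ⟦ top d ⟧ k
back-represents σ d k D = mk⇔
  (λ eq → trans (sym (minus-plus _ _)) (cong (_+ ⟦ top d ⟧ k) (trans (sym (⟦back⟧ σ d k)) eq)))
  (λ eq → trans (⟦back⟧ σ d k) (trans (cong (_- ⟦ top d ⟧ k) eq) (plus-minus D _)))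
  where
  minus-plus : ∀ x y → (x - y) + y ≡ x
  minus-plus = solve-∀
  plus-minus : ∀ x y → (x + y) - y ≡ x
  plus-minus = solve-∀

NonNeg : Form → Set
NonNeg (a , b) = 0ℤ ≤ a + b × 0ℤ ≤ a + (a + b)

Pos : Form → Set
Pos (a , b) = 0ℤ ≤ a + b × 0ℤ < a + (a + b)

fib-suc-pos : ∀ n → 0 ℕ.< fib (suc n)
fib-suc-pos zero    = s≤s z≤n
fib-suc-pos (suc n) = ℕ.<-≤-trans (fib-suc-pos n) (ℕ.m≤m+n _ _)

0≤F* : ∀ n {t} → 0ℤ ≤ t → 0ℤ ≤ F n * t
0≤F* n {t} 0≤t = subst (_≤ F n * t) (ℤ.*-zeroʳ (F n)) (ℤ.*-monoˡ-≤-nonNeg (F n) 0≤t)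

nonNeg-sound : ∀ v → NonNeg v → ∀ k → 0ℤ ≤ ⟦ v ⟧ k
nonNeg-sound (a , b) (0≤s , _)   zero    rewrite ⟦⟧-zero a b   = 0≤s
nonNeg-sound (a , b) (0≤s , 0≤t) (suc j) rewrite ⟦⟧-suc a b j =
  ℤ.+-mono-≤ (0≤F* j 0≤s) (0≤F* (suc j) 0≤t)

pos-sound : ∀ v → Pos v → ∀ j → 0ℤ < ⟦ v ⟧ (suc j)
pos-sound (a , b) (0≤s , 0<t) j rewrite ⟦⟧-suc a b j =
  ℤ.+-mono-≤-< (0≤F* j 0≤s) (subst (_< F (suc j) * _) (ℤ.*-zeroʳ (F (suc j))) F*0<F*t)
  where
  F*0<F*t : F (suc j) * 0ℤ < F (suc j) * (a + (a + b))
  F*0<F*t = ℤ.*-monoˡ-<-pos (F (suc j)) {{ℤ.positive (+<+ (fib-suc-pos j))}} 0<t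

infix 4 _≼_ _≺_ _≼?_ _≺?_

record _≼_ (v w : Form) : Set where
  constructor ≼-intro
  field ≼-nonNeg : NonNeg (w ⊖ v)

record _≺_ (v w : Form) : Set where
  constructor ≺-intro
  field ≺-pos : Pos (w ⊖ v)

_≼?_ : ∀ v w → Dec (v ≼ w)
v ≼? w = Dec.map′ ≼-intro _≼_.≼-nonNeg ((0ℤ ℤ.≤? _) ×-dec (0ℤ ℤ.≤? _))

_≺?_ : ∀ v w → Dec (v ≺ w)
v ≺? w = Dec.map′ ≺-intro _≺_.≺-pos ((0ℤ ℤ.≤? _) ×-dec (0ℤ ℤ.<? _))

≼-sound : ∀ {v w} → v ≼ w → ∀ k → ⟦ v ⟧ k ≤ ⟦ w ⟧ k
≼-sound {v} {w} (≼-intro w-v≥0) k =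
  ℤ.0≤i-j⇒j≤i (subst (0ℤ ≤_) (⟦⟧-⊖ w v k) (nonNeg-sound (w ⊖ v) w-v≥0 k))

≺-sound : ∀ {v w} → v ≺ w → ∀ j → ⟦ v ⟧ (suc j) < ⟦ w ⟧ (suc j)
≺-sound {v} {w} (≺-intro w-v>0) j =
  subst₂ _<_ (ℤ.+-identityʳ (⟦ v ⟧ (suc j))) (cancel (⟦ v ⟧ (suc j)) (⟦ w ⟧ (suc j)))
    (ℤ.+-monoʳ-< (⟦ v ⟧ (suc j)) (subst (0ℤ <_) (⟦⟧-⊖ w v (suc j)) (pos-sound (w ⊖ v) w-v>0 j)))
  where
  cancel : ∀ x y → x + (y - x) ≡ y
  cancel = solve-∀

Bounds : Set
Bounds = Form × Form

record Within (B : Bounds) (k : ℕ) (P : ℤ) : Set where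
  constructor within
  field
    lower≤ : ⟦ proj₁ B ⟧ k ≤ P
    <upper : P < ⟦ proj₂ B ⟧ k

record Extends (B : Bounds) (d : ℤ) (B′ : Bounds) : Set where
  constructor extends
  field
    lower-step : shift (proj₁ B′) ≼ proj₁ B ⊕ top d
    upper-step : proj₂ B ⊕ top d ≼ shift (proj₂ B′)

_extends?_to_ : ∀ B d B′ → Dec (Extends B d B′)
(lo , hi) extends? d to (lo′ , hi′) =
  Dec.map′ (λ (l , u) → extends l u) (λ (extends l u) → l , u)
           ((shift lo′ ≼? lo ⊕ top d) ×-dec (hi ⊕ top d ≼? shift hi′))

within-extend : ∀ {B B′ d k P} → Extends B d B′ → Within B k P → Within B′ (suc k) (P + ⟦ top d ⟧ k)
within-extend {lo , hi} {lo′ , hi′} {d} {k} {P} (extends lo′≼ ≼hi′) (within lo≤P P<hi) =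
  within bound-below bound-above
  where
  open ℤ.≤-Reasoning
  bound-below : ⟦ lo′ ⟧ (suc k) ≤ P + ⟦ top d ⟧ k
  bound-below = begin
    ⟦ lo′ ⟧ (suc k)           ≡⟨ ⟦⟧-shift lo′ k ⟨
    ⟦ shift lo′ ⟧ k           ≤⟨ ≼-sound lo′≼ k ⟩
    ⟦ lo ⊕ top d ⟧ k          ≡⟨ ⟦⟧-⊕ lo (top d) k ⟩
    ⟦ lo ⟧ k + ⟦ top d ⟧ k    ≤⟨ ℤ.+-monoˡ-≤ _ lo≤P ⟩
    P + ⟦ top d ⟧ k           ∎
  bound-above : P + ⟦ top d ⟧ k < ⟦ hi′ ⟧ (suc k)
  bound-above = begin-strict
    P + ⟦ top d ⟧ k           <⟨ ℤ.+-monoˡ-< _ P<hi ⟩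
    ⟦ hi ⟧ k + ⟦ top d ⟧ k    ≡⟨ ⟦⟧-⊕ hi (top d) k ⟨
    ⟦ hi ⊕ top d ⟧ k          ≤⟨ ≼-sound ≼hi′ k ⟩
    ⟦ shift hi′ ⟧ k           ≡⟨ ⟦⟧-shift hi′ k ⟩
    ⟦ hi′ ⟧ (suc k)           ∎

-- The carry automaton

uDigit xDigit : Σ₂₃ → ℕ
uDigit (u , _) = toℕ u
xDigit (_ , x) = toℕ x

diff : Σ₂₃ → ℤ
diff a = + uDigit a - + xDigit a

Local : Set
Local = Bool × CGState

localStep : Local → Σ₂₃ → Maybe Local
localStep = zipStep zStep cgStep uDigit xDigit

initialLocal : Local
initialLocal = false , cg true false

-- The value of a prefix of length k lies in [⟦ lo ⟧ k , ⟦ hi ⟧ k).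
zBounds : Bool → Bounds
zBounds false = (0ℤ , 0ℤ) , (0ℤ , 1ℤ)
zBounds true  = (0ℤ , 1ℤ) , (1ℤ , 0ℤ)

cgBounds : CGState → Bounds
cgBounds (cg true  false) = (0ℤ , 0ℤ) , (0ℤ , 1ℤ)
cgBounds (cg true  true)  = (0ℤ , 1ℤ) , (1ℤ , 0ℤ)
cgBounds (cg false false) = (0ℤ , 0ℤ) , (1ℤ , 0ℤ)
cgBounds (cg false true)  = (1ℤ , 0ℤ) , (1ℤ , 1ℤ)

record InBounds (l : Local) (k : ℕ) (Pu Px : ℤ) : Set where
  constructor inBounds
  field
    zeckendorf-within  : Within (zBounds (proj₁ l)) k Pu
    chungGraham-within : Within (cgBounds (proj₂ l)) k Px

window : Local → Bounds
window (z , c) = proj₁ (zBounds z) ⊖ proj₂ (cgBounds c) , proj₂ (zBounds z) ⊖ proj₁ (cgBounds c)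

Refuted : Local → Form → Set
Refuted l σ = σ ≼ proj₁ (window l) ⊎ proj₂ (window l) ≼ σ

-- The carries from which a completion exists: the least table that contains (0 , 0) wherever
-- D = 0 is not refuted and that is closed under back.
allowed : Local → List Form
allowed (false , cg true  false) = (0ℤ , 0ℤ) ∷ (1ℤ , -1ℤ) ∷ []
allowed (false , cg true  true)  = (0ℤ , -1ℤ) ∷ []
allowed (false , cg false false) = (-1ℤ , 1ℤ) ∷ (0ℤ , 0ℤ) ∷ []
allowed (false , cg false true)  = (-1ℤ , 0ℤ) ∷ []
allowed (true  , cg true  false) = (1ℤ , -1ℤ) ∷ []
allowed (true  , cg true  true)  = (0ℤ , 0ℤ) ∷ []
allowed (true  , cg false false) = (0ℤ , 0ℤ) ∷ (0ℤ , 1ℤ) ∷ []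
allowed (true  , cg false true)  = []

bools : List Bool
bools = false ∷ true ∷ []

∈-bools : ∀ b → b ∈ bools
∈-bools false = here refl
∈-bools true  = there (here refl)

locals : List Local
locals = cartesianProduct bools (map (λ (e , p) → cg e p) (cartesianProduct bools bools))

∈-locals : ∀ l → l ∈ locals
∈-locals (z , cg e p) =
  ∈-cartesianProduct⁺ (∈-bools z)
                      (∈-map⁺ (λ (e , p) → cg e p) (∈-cartesianProduct⁺ (∈-bools e) (∈-bools p)))

letters : List Σ₂₃
letters = cartesianProduct (allFin 2) (allFin 3)

∈-letters : ∀ a → a ∈ letters
∈-letters (u , x) = ∈-cartesianProduct⁺ (∈-allFin u) (∈-allFin x)

BoundsExtend : Local → Σ₂₃ → Local → Set
BoundsExtend (z , c) a (z′ , c′) =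
  Extends (zBounds z) (+ uDigit a) (zBounds z′) × Extends (cgBounds c) (+ xDigit a) (cgBounds c′)

AllowedOrRefuted : Local → Form → Set
AllowedOrRefuted l σ = σ ∈ allowed l ⊎ Refuted l σ

allowedOrRefuted? : ∀ l σ → Dec (AllowedOrRefuted l σ)
allowedOrRefuted? l σ = (σ ∈? allowed l) ⊎-dec ((σ ≼? proj₁ (window l)) ⊎-dec (proj₂ (window l) ≼? σ))

Separated : Form → Form → Set
Separated σ τ = σ ≡ τ ⊎ σ ≺ τ ⊎ τ ≺ σ

abstract
  bounds-extend : ∀ l a → MaybeAll (BoundsExtend l a) (localStep l a)
  bounds-extend = from-yes (∀? ∈-locals λ (z , c) → ∀? ∈-letters λ a → MaybeAll.dec
    (λ (z′ , c′) → (zBounds z extends? + uDigit a to zBounds z′)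
                   ×-dec (cgBounds c extends? + xDigit a to cgBounds c′))
    (localStep (z , c) a))

  zero-allowedOrRefuted : ∀ l → AllowedOrRefuted l (0ℤ , 0ℤ)
  zero-allowedOrRefuted = from-yes (∀? ∈-locals λ l → allowedOrRefuted? l (0ℤ , 0ℤ))

  back-allowedOrRefuted : ∀ l a →
    MaybeAll (λ l′ → All (λ σ → AllowedOrRefuted l (back σ (diff a))) (allowed l′)) (localStep l a)
  back-allowedOrRefuted = from-yes (∀? ∈-locals λ l → ∀? ∈-letters λ a → MaybeAll.dec
    (λ l′ → All.all? (λ σ → allowedOrRefuted? l (back σ (diff a))) (allowed l′)) (localStep l a))

  allowed-separated : ∀ l → All (λ σ → All (Separated σ) (allowed l)) (allowed l)
  allowed-separated = from-yes (∀? ∈-locals λ l → All.all? (λ σ → All.all?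
    (λ τ → (σ ≟F τ) ⊎-dec (σ ≺? τ) ⊎-dec (τ ≺? σ)) (allowed l)) (allowed l))

window-bounds : ∀ {l k Pu Px} → InBounds l k Pu Px →
                ⟦ proj₁ (window l) ⟧ k < Pu - Px × Pu - Px < ⟦ proj₂ (window l) ⟧ k
window-bounds {z , c} {k} {Pu} {Px} (inBounds (within lo≤Pu Pu<hi) (within lo≤Px Px<hi)) =
  subst (_< Pu - Px) (sym (⟦⟧-⊖ (proj₁ (zBounds z)) (proj₂ (cgBounds c)) k))
        (ℤ.+-mono-≤-< lo≤Pu (ℤ.neg-mono-< Px<hi)) ,
  subst (Pu - Px <_) (sym (⟦⟧-⊖ (proj₂ (zBounds z)) (proj₁ (cgBounds c)) k))
        (ℤ.+-mono-<-≤ Pu<hi (ℤ.neg-mono-≤ lo≤Px))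

not-refuted : ∀ {l k Pu Px σ} → InBounds l k Pu Px → ⟦ σ ⟧ k ≡ Pu - Px → ¬ Refuted l σ
not-refuted {l} {k} bounds σ≡D (inj₁ σ≼lo) =
  ℤ.<⇒≱ (proj₁ (window-bounds {l} {k} bounds))
        (subst (_≤ ⟦ proj₁ (window l) ⟧ k) σ≡D (≼-sound σ≼lo k))
not-refuted {l} {k} bounds σ≡D (inj₂ hi≼σ) =
  ℤ.<⇒≱ (proj₂ (window-bounds {l} {k} bounds))
        (subst (⟦ proj₂ (window l) ⟧ k ≤_) σ≡D (≼-sound hi≼σ k))

allowed-if-consistent : ∀ {l k Pu Px σ} → AllowedOrRefuted l σ → InBounds l k Pu Px → ⟦ σ ⟧ k ≡ Pu - Px →
                        σ ∈ allowed l
allowed-if-consistent             (inj₁ σ∈)      _      _   = σ∈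
allowed-if-consistent {l} {k} (inj₂ refuted) bounds σ≡D = ⊥-elim (not-refuted {l} {k} bounds σ≡D refuted)

allowed-unique : ∀ {l σ τ} j → σ ∈ allowed l → τ ∈ allowed l →
                 ⟦ σ ⟧ (suc j) ≡ ⟦ τ ⟧ (suc j) → σ ≡ τ
allowed-unique {l} j σ∈ τ∈ σ≡τ with All.lookup (All.lookup (allowed-separated l) σ∈) τ∈
... | inj₁ σ≡τ′       = σ≡τ′
... | inj₂ (inj₁ σ≺τ) = ⊥-elim (ℤ.<-irrefl σ≡τ (≺-sound σ≺τ j))
... | inj₂ (inj₂ τ≺σ) = ⊥-elim (ℤ.<-irrefl (sym σ≡τ) (≺-sound τ≺σ j))

extend : ℕ → ℕ → ℕ → ℕ
extend k P d = P ℕ.+ d ℕ.* fib (k ℕ.+ 2)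

+-extend : ∀ k P d → + extend k P d ≡ + P + ⟦ top (+ d) ⟧ k
+-extend k P d = begin
  + (P ℕ.+ d ℕ.* fib (k ℕ.+ 2))  ≡⟨ ℤ.pos-+ P _ ⟩
  + P + + (d ℕ.* fib (k ℕ.+ 2))  ≡⟨ cong (λ n → + P + + (d ℕ.* fib n)) (ℕ.+-comm k 2) ⟩
  + P + + (d ℕ.* fib (2 ℕ.+ k))  ≡⟨ cong (_+_ (+ P)) (ℤ.pos-* d (fib (2 ℕ.+ k))) ⟩
  + P + + d * F (2 ℕ.+ k)        ≡⟨ cong (_+_ (+ P)) (⟦top⟧ (+ d) k) ⟨
  + P + ⟦ top (+ d) ⟧ k          ∎
  where open ≡-Reasoning

difference-extend : ∀ k Pu Px a →
  + extend k Pu (uDigit a) - + extend k Px (xDigit a) ≡ (+ Pu - + Px) + ⟦ top (diff a) ⟧ k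
difference-extend k Pu Px a = begin
  + extend k Pu (uDigit a) - + extend k Px (xDigit a)
    ≡⟨ cong₂ _-_ (+-extend k Pu (uDigit a)) (+-extend k Px (xDigit a)) ⟩
  (+ Pu + ⟦ top (+ uDigit a) ⟧ k) - (+ Px + ⟦ top (+ xDigit a) ⟧ k)
    ≡⟨ regroup (+ Pu) (+ Px) (⟦ top (+ uDigit a) ⟧ k) (⟦ top (+ xDigit a) ⟧ k) ⟩
  (+ Pu - + Px) + (⟦ top (+ uDigit a) ⟧ k - ⟦ top (+ xDigit a) ⟧ k)
    ≡⟨ cong (_+_ (+ Pu - + Px)) (⟦⟧-⊖ (top (+ uDigit a)) (top (+ xDigit a)) k) ⟨
  (+ Pu - + Px) + ⟦ top (diff a) ⟧ k
    ∎
  where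
  open ≡-Reasoning
  regroup : ∀ p q a b → (p + a) - (q + b) ≡ (p - q) + (a - b)
  regroup = solve-∀

first-difference : ∀ a → + extend 0 0 (uDigit a) - + extend 0 0 (xDigit a) ≡ diff a
first-difference a = begin
  + extend 0 0 (uDigit a) - + extend 0 0 (xDigit a) ≡⟨ difference-extend 0 0 0 a ⟩
  0ℤ + ⟦ top (diff a) ⟧ 0                           ≡⟨ ℤ.+-identityˡ _ ⟩
  ⟦ top (diff a) ⟧ 0                                ≡⟨ ⟦top⟧ (diff a) 0 ⟩
  diff a * 1ℤ                                       ≡⟨ ℤ.*-identityʳ (diff a) ⟩
  diff a                                            ∎
  where open ≡-Reasoning

record Completes (l : Local) (k Pu Px : ℕ) (w : List Σ₂₃) : Set where
  constructor completes
  field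
    runs     : Runs localStep l w
    balanced : Pu ℕ.+ valFrom k (upper w) ≡ Px ℕ.+ valFrom k (lower w)

completes-∷ : ∀ {l a l′ k Pu Px w} → localStep l a ≡ just l′ →
              Completes l k Pu Px (a ∷ w) ⇔ Completes l′ (suc k) (extend k Pu (uDigit a)) (extend k Px (xDigit a)) w
completes-∷ {Pu = Pu} {Px} eq = mk⇔
  (λ (completes r h) → completes (Equivalence.to (runs-∷ eq) r)
                                 (trans (ℕ.+-assoc Pu _ _) (trans h (sym (ℕ.+-assoc Px _ _)))))
  (λ (completes r h) → completes (Equivalence.from (runs-∷ eq) r)
                                 (trans (sym (ℕ.+-assoc Pu _ _)) (trans h (ℕ.+-assoc Px _ _))))

completes-stuck : ∀ {l a k Pu Px w} → localStep l a ≡ nothing → ¬ Completes l k Pu Px (a ∷ w)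
completes-stuck eq (completes r _) = runs-stuck eq r

completes-[] : ∀ {l k Pu Px} → Completes l k Pu Px [] ⇔ (+ Pu - + Px ≡ 0ℤ)
completes-[] {Pu = Pu} {Px} = mk⇔
  (λ (completes _ h) → ℤ.i≡j⇒i-j≡0 (cong +_ (trans (sym (ℕ.+-identityʳ Pu)) (trans h (ℕ.+-identityʳ Px)))))
  (λ h → completes [] (trans (ℕ.+-identityʳ Pu)
                             (trans (ℤ.+-injective (ℤ.i-j≡0⇒i≡j _ _ h)) (sym (ℕ.+-identityʳ Px)))))

initial-bounds : InBounds initialLocal 0 (+ 0) (+ 0)
initial-bounds = inBounds (within (+≤+ z≤n) (+<+ (s≤s z≤n))) (within (+≤+ z≤n) (+<+ (s≤s z≤n)))

inBounds-extend : ∀ {l a l′ k Pu Px} → localStep l a ≡ just l′ → InBounds l k (+ Pu) (+ Px) →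
                  InBounds l′ (suc k) (+ extend k Pu (uDigit a)) (+ extend k Px (xDigit a))
inBounds-extend {l} {a} {k = k} {Pu} {Px} eq (inBounds zb cb)
  with zext , cext ← MaybeAll.drop-just (subst (MaybeAll _) eq (bounds-extend l a)) =
  inBounds (subst (Within _ (suc k)) (sym (+-extend k Pu (uDigit a))) (within-extend zext zb))
           (subst (Within _ (suc k)) (sym (+-extend k Px (xDigit a))) (within-extend cext cb))

zero-allowed : ∀ {l k Pu Px} → InBounds l k Pu Px → Pu - Px ≡ 0ℤ → (0ℤ , 0ℤ) ∈ allowed l
zero-allowed {l} {k} bounds D≡0 = allowed-if-consistent {l} {k} (zero-allowedOrRefuted l) bounds (sym D≡0)

back-allowed : ∀ {l a l′ k Pu Px σ′} → localStep l a ≡ just l′ → InBounds l k (+ Pu) (+ Px) →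
               σ′ ∈ allowed l′ →
               ⟦ σ′ ⟧ (suc k) ≡ + extend k Pu (uDigit a) - + extend k Px (xDigit a) →
               back σ′ (diff a) ∈ allowed l × ⟦ back σ′ (diff a) ⟧ k ≡ + Pu - + Px
back-allowed {l} {a} {k = k} {Pu} {Px} {σ′} eq bounds σ′∈ σ′-represents =
  allowed-if-consistent {l} {k} back-closed bounds represents , represents
  where
  represents : ⟦ back σ′ (diff a) ⟧ k ≡ + Pu - + Px
  represents = Equivalence.from (back-represents σ′ (diff a) k (+ Pu - + Px))
                                (trans σ′-represents (difference-extend k Pu Px a))
  back-closed : AllowedOrRefuted l (back σ′ (diff a))
  back-closed = All.lookup (MaybeAll.drop-just (subst (MaybeAll _) eq (back-allowedOrRefuted l a))) σ′∈

completion-represented : ∀ w {l k Pu Px} → InBounds l k (+ Pu) (+ Px) → Completes l k Pu Px w →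
                         ∃[ σ ] σ ∈ allowed l × ⟦ σ ⟧ k ≡ + Pu - + Px
completion-represented [] {l} {k} {Pu} {Px} bounds c = (0ℤ , 0ℤ) , zero-allowed {l} {k} bounds D≡0 , sym D≡0
  where
  D≡0 : + Pu - + Px ≡ 0ℤ
  D≡0 = Equivalence.to completes-[] c
completion-represented (a ∷ w) {l} {k} {Pu} {Px} bounds c = by-step (localStep l a) refl
  where
  by-step : ∀ m → localStep l a ≡ m → ∃[ σ ] σ ∈ allowed l × ⟦ σ ⟧ k ≡ + Pu - + Px
  by-step nothing   eq = ⊥-elim (completes-stuck eq c)
  by-step (just l′) eq =
    let σ′ , σ′∈ , σ′-represents =
          completion-represented w (inBounds-extend eq bounds) (Equivalence.to (completes-∷ eq) c)
    in back σ′ (diff a) , back-allowed eq bounds σ′∈ σ′-represents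

data State : Set where
  start dead : State
  live       : Local → Form → State

enter : Local → {P : Form → Set} → U.Decidable P → State
enter l P? with Any.any? P? (allowed l)
... | yes found = live l (proj₁ (find found))
... | no _      = dead

move : Local → Σ₂₃ → {P : Form → Set} → U.Decidable P → State
move l a P? = Maybe.maybe′ (λ l′ → enter l′ P?) dead (localStep l a)

-- At level 0 both (0 , 0) and (1 , -1) represent D = 0, so the first carry is looked up by its value
-- at level 1 instead of being computed with back.
step : State → Σ₂₃ → State
step start      a = move initialLocal a (λ σ → ⟦ σ ⟧ 1 ℤ.≟ diff a)
step dead       _ = dead
step (live l τ) a = move l a (λ σ → back σ (diff a) ≟F τ)

accepting : State → Bool
accepting start      = true
accepting dead       = false
accepting (live _ τ) = does (τ ≟F (0ℤ , 0ℤ))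

AcceptedFrom : State → List Σ₂₃ → Set
AcceptedFrom q w = accepting (foldl step q w) ≡ true

dead-rejects : ∀ w → ¬ AcceptedFrom dead w
dead-rejects []      ()
dead-rejects (_ ∷ w) = dead-rejects w

module _ {l : Local} {a : Σ₂₃} {k Pu Px : ℕ} where
  private
    Pu′ Px′ : ℕ
    Pu′ = extend k Pu (uDigit a)
    Px′ = extend k Px (xDigit a)

  move-correct : ∀ {w P} (P? : U.Decidable P) → InBounds l k (+ Pu) (+ Px) →
    (∀ {l′ σ} → localStep l a ≡ just l′ → σ ∈ allowed l′ →
                P σ ⇔ (⟦ σ ⟧ (suc k) ≡ + Pu′ - + Px′)) →
    (∀ {l′ σ} → InBounds l′ (suc k) (+ Pu′) (+ Px′) → σ ∈ allowed l′ →
                ⟦ σ ⟧ (suc k) ≡ + Pu′ - + Px′ → AcceptedFrom (live l′ σ) w ⇔ Completes l′ (suc k) Pu′ Px′ w) →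
    AcceptedFrom (move l a P?) w ⇔ Completes l k Pu Px (a ∷ w)
  move-correct {w} P? bounds P⇔represents accepted⇔completes = by-step (localStep l a) refl
    where
    entering : ∀ l′ → localStep l a ≡ just l′ → AcceptedFrom (enter l′ P?) w ⇔ Completes l k Pu Px (a ∷ w)
    entering l′ eq with Any.any? P? (allowed l′)
    ... | yes found = let σ , σ∈ , Pσ = find found in
      ⇔.trans (accepted⇔completes (inBounds-extend eq bounds) σ∈ (Equivalence.to (P⇔represents eq σ∈) Pσ))
              (⇔.sym (completes-∷ eq))
    ... | no none = mk⇔ (λ acc → ⊥-elim (dead-rejects w acc)) λ c →
      let σ , σ∈ , σ-represents =
            completion-represented w (inBounds-extend eq bounds) (Equivalence.to (completes-∷ eq) c)
      in ⊥-elim (none (lose σ∈ (Equivalence.from (P⇔represents eq σ∈) σ-represents)))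
    by-step : ∀ m → localStep l a ≡ m →
              AcceptedFrom (Maybe.maybe′ (λ l′ → enter l′ P?) dead m) w ⇔ Completes l k Pu Px (a ∷ w)
    by-step nothing   eq = mk⇔ (λ acc → ⊥-elim (dead-rejects w acc)) (λ c → ⊥-elim (completes-stuck eq c))
    by-step (just l′) eq = entering l′ eq

live-correct : ∀ w {l j Pu Px τ} → InBounds l (suc j) (+ Pu) (+ Px) → τ ∈ allowed l →
               ⟦ τ ⟧ (suc j) ≡ + Pu - + Px → AcceptedFrom (live l τ) w ⇔ Completes l (suc j) Pu Px w
live-correct [] {l} {j} {Pu} {Px} {τ} bounds τ∈ τ-represents =
  ⇔.trans (mk⇔ balanced accepted) (⇔.sym completes-[])
  where
  balanced : does (τ ≟F (0ℤ , 0ℤ)) ≡ true → + Pu - + Px ≡ 0ℤ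
  balanced acc with τ ≟F (0ℤ , 0ℤ)
  ... | yes τ≡0 = trans (sym τ-represents) (cong (λ σ → ⟦ σ ⟧ (suc j)) τ≡0)
  ... | no _ with () ← acc
  accepted : + Pu - + Px ≡ 0ℤ → does (τ ≟F (0ℤ , 0ℤ)) ≡ true
  accepted D≡0 =
    dec-true (τ ≟F _) (allowed-unique j τ∈ (zero-allowed {l} {suc j} bounds D≡0) (trans τ-represents D≡0))
live-correct (a ∷ w) {l} {j} {Pu} {Px} {τ} bounds τ∈ τ-represents =
  move-correct (λ σ → back σ (diff a) ≟F τ) bounds back≡τ⇔represents (live-correct w)
  where
  back≡τ⇔represents : ∀ {l′ σ} → localStep l a ≡ just l′ → σ ∈ allowed l′ →
    (back σ (diff a) ≡ τ) ⇔
    (⟦ σ ⟧ (suc (suc j)) ≡ + extend (suc j) Pu (uDigit a) - + extend (suc j) Px (xDigit a))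
  back≡τ⇔represents {σ = σ} eq σ∈ = mk⇔
    (λ back≡τ → trans (Equivalence.to (back-represents σ (diff a) (suc j) (+ Pu - + Px))
                                      (trans (cong (λ ρ → ⟦ ρ ⟧ (suc j)) back≡τ) τ-represents))
                      (sym (difference-extend (suc j) Pu Px a)))
    (λ σ-represents → let back∈ , back-represents-D = back-allowed eq bounds σ∈ σ-represents
                      in allowed-unique j back∈ τ∈ (trans back-represents-D (sym τ-represents)))

start-correct : ∀ w → AcceptedFrom start w ⇔ Completes initialLocal 0 0 0 w
start-correct []      = mk⇔ (λ _ → completes [] refl) (λ _ → refl)
start-correct (a ∷ w) = move-correct (λ σ → ⟦ σ ⟧ 1 ℤ.≟ diff a) initial-bounds
  (λ _ _ → mk⇔ (λ eq → trans eq (sym (first-difference a))) (λ eq → trans eq (first-difference a)))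
  (live-correct w)

lives : Local → List State
lives l = map (live l) (allowed l)

states : List State
states = start ∷ dead ∷ concatMap lives locals

live-∈ : ∀ {l σ} → σ ∈ allowed l → live l σ ∈ states
live-∈ {l} σ∈ = there (there (∈-concatMap⁺ lives (lose (∈-locals l) (∈-map⁺ (live l) σ∈))))

enter-∈ : ∀ l {P} (P? : U.Decidable P) → enter l P? ∈ states
enter-∈ l P? with Any.any? P? (allowed l)
... | yes found = live-∈ (proj₁ (proj₂ (find found)))
... | no _      = there (here refl)

move-∈ : ∀ l a {P} (P? : U.Decidable P) → move l a P? ∈ states
move-∈ l a P? = Maybe.maybe {B = λ m → Maybe.maybe′ (λ l′ → enter l′ P?) dead m ∈ states}
                            (λ l′ → enter-∈ l′ P?) (there (here refl)) (localStep l a)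

step-∈ : ∀ q a → step q a ∈ states
step-∈ start      a = move-∈ initialLocal a _
step-∈ dead       _ = there (here refl)
step-∈ (live l τ) a = move-∈ l a _

inL⇔completes : ∀ w → InL w ⇔ Completes initialLocal 0 0 0 w
inL⇔completes w = ⇔.trans (zeckendorf⇔runs (upper w) ×-⇔ chungGraham⇔runs (lower w) ×-⇔ ⇔.refl) (mk⇔
  (λ (zr , cr , balanced) → completes (Equivalence.from runs⇔ (zr , cr)) balanced)
  (λ (completes r balanced) → let zr , cr = Equivalence.to runs⇔ r in zr , cr , balanced))
  where
  runs⇔ : Runs localStep initialLocal w ⇔ (Runs zStep false (upper w) × Runs cgStep (cg true false) (lower w))
  runs⇔ = runs-zipStep zStep cgStep uDigit xDigit false (cg true false) w

mainTheorem1 : ∃[ D ] (∀ (w : List Σ₂₃) → Accepts {Σ₂₃} D w ⇔ InL w)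
mainTheorem1 =
  let D , accepts⇔accepted = finite-reachable⇒DFA step start accepting states (here refl) (λ {q} a _ → step-∈ q a)
  in D , λ w → ⇔.trans (accepts⇔accepted w) (⇔.trans (start-correct w) (⇔.sym (inL⇔completes w)))
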